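{- Let $d\geq 2$ be an integer. Then there is a positive integer $N_d$ such that $$\left(\frac{1}{d!\,\zeta(d)}\right)n^d\leq\beta_n^d\leq n^d\quad\text{for all } n>N_d,$$ where $\zeta$ is the Riemann zeta function.
   Context: $\mathbb{Z}_n$ is the ring of integers modulo $n$, identified with $\{0,\dots,n-1\}$; a vector $(v_1,\dots,v_d)\in\mathbb{Z}_n^d$ is zero-sum-free if no non-empty subset of its components sums to $0$ in $\mathbb{Z}_n$; $\beta_n^d$ is the number of zero-sum-free $(x_1,\dots,x_d)\in\mathbb{Z}_n^d$ with $\gcd(x_1,\dots,x_d,n)=1$. -}

module Defs where

open import Data.Bool using (Bool; true; false; _∧_; not; if_then_else_)
open import Data.Nat using (ℕ; zero; suc; _+_; _^_; _!; _≡ᵇ_)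
open import Data.Nat.Properties using (_!≢0)
open import Data.Nat.GCD using (gcd)
open import Data.Nat.Divisibility using (_∣?_)
open import Data.List using (List; []; _∷_; _++_; map; concatMap; upTo; length; filterᵇ)
open import Data.Bool.ListAction using (and)
open import Data.Vec using (Vec; []; _∷_; foldr)
open import Data.Integer using (+_)
open import Data.Rational using (ℚ; 0ℚ; 1ℚ; _/_; _*_) renaming (_+_ to _+ℚ_)
open import Relation.Nullary.Decidable using (does)

-- Z_n identified with {0,…,n-1}; all vectors of Z_n^d as Vec ℕ d with entries < n.
vectors : (d n : ℕ) → List (Vec ℕ d)
vectors zero    n = [] ∷ []
vectors (suc d) n = concatMap (λ a → map (a ∷_) (vectors d n)) (upTo n)

allSubsetSums : ∀ {d} → Vec ℕ d → List ℕ
allSubsetSums []      = 0 ∷ []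
allSubsetSums (x ∷ v) = allSubsetSums v ++ map (λ s → x + s) (allSubsetSums v)

nonemptySubsetSums : ∀ {d} → Vec ℕ d → List ℕ
nonemptySubsetSums []      = []
nonemptySubsetSums (x ∷ v) = nonemptySubsetSums v ++ map (λ s → x + s) (allSubsetSums v)

zeroSumFree : (n : ℕ) → ∀ {d} → Vec ℕ d → Bool
zeroSumFree n v = and (map (λ s → not (does (n ∣? s))) (nonemptySubsetSums v))

gcdWithIsOne : (n : ℕ) → ∀ {d} → Vec ℕ d → Bool
gcdWithIsOne n v = foldr (λ _ → ℕ) gcd n v ≡ᵇ 1

β : (n d : ℕ) → ℕ
β n d = length (filterᵇ (λ v → zeroSumFree n v ∧ gcdWithIsOne n v) (vectors d n))

_^ℚ_ : ℚ → ℕ → ℚ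
q ^ℚ zero  = 1ℚ
q ^ℚ suc k = q * (q ^ℚ k)

zetaPartial : (d K : ℕ) → ℚ
zetaPartial d zero    = 0ℚ
zetaPartial d (suc K) = zetaPartial d K +ℚ (((+ 1) / suc K) ^ℚ d)

powOverFact : (n d : ℕ) → ℚ
powOverFact n d = (+ (n ^ d)) / (d !)
  where instance _ = d !≢0

-- For n = m + 1 let S be the vectors of Z_n^d with positive entries summing to at most m.
-- Each v ∈ S is zero-sum-free, since its non-empty subset sums lie in [1, m]; so is each v with
-- -v ∈ S, since a subset sum of v is a multiple of n minus a subset sum of -v.  For d ≥ 2 the
-- two families are disjoint and -v is coprime to n exactly when v is, hence β ≥ 2 G with
-- G the number of v ∈ S coprime to n.  Counting compositions, |S| ≥ (n - d)^d / d!, while the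
-- v ∈ S sharing a factor with n all have entries divisible by some q ∈ {2, 3, 5, 7, 9, …},
-- and there are at most m^d / (q² d!) of these for each q.  As Σ 1/q² ≤ 35/72 and
-- (n - d)^d ≥ (71/72) n^d for n ≥ 72 d², this gives β ≥ n^d / d!, so the lower bound holds
-- already with the first partial sum ζ_1 = 1.  The upper bound β ≤ n^d is trivial.

module Submission where

module FiniteSums where

  open import Data.Bool using (Bool; true; false; _∧_; if_then_else_)
  open import Data.Nat
  open import Data.Nat.Properties
  open import Data.Nat.Divisibility using (_∣?_; _∣0; ∣⇒≤; ∣m+n∣m⇒∣n; ∣m∣n⇒∣m+n; ∣-refl)
  open import Function using (_∘_; mk⇔)
  open import Relation.Nullary.Decidable using (does; dec-true; dec-false; does-⇔)
  open import Relation.Binary.PropositionalEquality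

  ∑ : ℕ → (ℕ → ℕ) → ℕ
  ∑ zero    f = 0
  ∑ (suc n) f = f 0 + ∑ n (f ∘ suc)

  infix 5 ∑
  syntax ∑ n (λ i → e) = ∑[ i < n ] e

  when : Bool → ℕ → ℕ
  when b x = if b then x else 0

  *-when : ∀ k b x → k * when b x ≡ when b (k * x)
  *-when k true  x = refl
  *-when k false x = *-zeroʳ k

  when-mono : ∀ b {x y} → x ≤ y → when b x ≤ when b y
  when-mono true  x≤y = x≤y
  when-mono false _   = z≤n

  when-∧-rotate : ∀ a b c x → when (a ∧ b ∧ c) x ≡ when c (when (a ∧ b) x)
  when-∧-rotate true  true  c     x = refl
  when-∧-rotate true  false true  x = refl
  when-∧-rotate true  false false x = refl
  when-∧-rotate false b     true  x = refl
  when-∧-rotate false b     false x = refl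

  ∑-cong : ∀ n {f g : ℕ → ℕ} → (∀ a → a < n → f a ≡ g a) → ∑ n f ≡ ∑ n g
  ∑-cong zero    f≗g = refl
  ∑-cong (suc n) f≗g = cong₂ _+_ (f≗g 0 z<s) (∑-cong n (λ a a<n → f≗g (suc a) (s<s a<n)))

  ∑-mono : ∀ n {f g : ℕ → ℕ} → (∀ a → a < n → f a ≤ g a) → ∑ n f ≤ ∑ n g
  ∑-mono zero    f≤g = z≤n
  ∑-mono (suc n) f≤g = +-mono-≤ (f≤g 0 z<s) (∑-mono n (λ a a<n → f≤g (suc a) (s<s a<n)))

  ∑-zero : ∀ n (f : ℕ → ℕ) → (∀ a → a < n → f a ≡ 0) → ∑ n f ≡ 0
  ∑-zero zero    f f≗0 = refl
  ∑-zero (suc n) f f≗0 = cong₂ _+_ (f≗0 0 z<s) (∑-zero n (f ∘ suc) (λ a a<n → f≗0 (suc a) (s<s a<n)))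

  ∑-const : ∀ n c → ∑[ _ < n ] c ≡ n * c
  ∑-const zero    c = refl
  ∑-const (suc n) c = cong (c +_) (∑-const n c)

  *-distribˡ-∑ : ∀ k n (f : ℕ → ℕ) → k * ∑ n f ≡ ∑[ a < n ] k * f a
  *-distribˡ-∑ k zero    f = *-zeroʳ k
  *-distribˡ-∑ k (suc n) f = trans (*-distribˡ-+ k (f 0) _) (cong (k * f 0 +_) (*-distribˡ-∑ k n (f ∘ suc)))

  ∑-last : ∀ n (f : ℕ → ℕ) → ∑ (suc n) f ≡ ∑ n f + f n
  ∑-last zero    f = +-comm (f 0) 0
  ∑-last (suc n) f = trans (cong (f 0 +_) (∑-last n (f ∘ suc))) (sym (+-assoc (f 0) _ _))

  ∑-+ : ∀ m k (f : ℕ → ℕ) → ∑ (m + k) f ≡ ∑ m f + (∑[ i < k ] f (m + i))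
  ∑-+ zero    k f = refl
  ∑-+ (suc m) k f = trans (cong (f 0 +_) (∑-+ m k (f ∘ suc))) (sym (+-assoc (f 0) _ _))

  ∑-mono-range : ∀ (f : ℕ → ℕ) {m k} → m ≤ k → ∑ m f ≤ ∑ k f
  ∑-mono-range f {m} {k} m≤k = begin
    ∑ m f                                 ≤⟨ m≤m+n _ _ ⟩
    ∑ m f + (∑[ i < k ∸ m ] f (m + i))    ≡⟨ ∑-+ m (k ∸ m) f ⟨
    ∑ (m + (k ∸ m)) f                     ≡⟨ cong (λ l → ∑ l f) (m+[n∸m]≡n m≤k) ⟩
    ∑ k f                                 ∎
    where open ≤-Reasoning

  ∑-truncate : ∀ (f : ℕ → ℕ) {k n} → k ≤ n → (∀ a → k ≤ a → f a ≡ 0) → ∑ n f ≡ ∑ k f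
  ∑-truncate f {k} {n} k≤n tail≡0 = begin
    ∑ n f                                 ≡⟨ cong (λ l → ∑ l f) (m+[n∸m]≡n k≤n) ⟨
    ∑ (k + (n ∸ k)) f                     ≡⟨ ∑-+ k (n ∸ k) f ⟩
    ∑ k f + (∑[ i < n ∸ k ] f (k + i))    ≡⟨ cong (∑ k f +_) (∑-zero (n ∸ k) _ (λ i _ → tail≡0 (k + i) (m≤m+n k i))) ⟩
    ∑ k f + 0                             ≡⟨ +-identityʳ _ ⟩
    ∑ k f                                 ∎
    where open ≡-Reasoning

  ∑-reverse : ∀ n (f : ℕ → ℕ) → ∑[ a < n ] f (n ∸ suc a) ≡ ∑ n f
  ∑-reverse zero    f = refl
  ∑-reverse (suc n) f = begin
    f n + (∑[ a < n ] f (n ∸ suc a))   ≡⟨ cong (f n +_) (∑-reverse n f) ⟩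
    f n + ∑ n f                        ≡⟨ +-comm (f n) _ ⟩
    ∑ n f + f n                        ≡⟨ ∑-last n f ⟨
    ∑ (suc n) f                        ∎
    where open ≡-Reasoning

  ∑-reflect : ∀ n (f : ℕ → ℕ) → f 0 ≡ 0 → f n ≡ 0 → ∑[ a < n ] f (n ∸ a) ≡ ∑ n f
  ∑-reflect zero    f f0≡0 fn≡0 = refl
  ∑-reflect (suc n) f f0≡0 fn≡0 = begin
    f (suc n) + (∑[ a < n ] f (n ∸ a))       ≡⟨ cong₂ _+_ fn≡0 (∑-cong n (λ a a<n → cong f (+-∸-assoc 1 a<n))) ⟩
    0 + (∑[ a < n ] f (suc (n ∸ suc a)))     ≡⟨ ∑-reverse n (f ∘ suc) ⟩
    ∑ n (f ∘ suc)                            ≡⟨ cong (_+ ∑ n (f ∘ suc)) f0≡0 ⟨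
    ∑ (suc n) f                              ∎
    where open ≡-Reasoning

  ∑-multiples : ∀ q .{{_ : NonZero q}} k (h : ℕ → ℕ) →
                ∑[ a < k * q ] when (does (q ∣? a)) (h a) ≡ ∑[ b < k ] h (b * q)
  ∑-multiples q           zero    h = refl
  ∑-multiples q@(suc q′) (suc k) h = begin
    ∑ (q + k * q) f                                           ≡⟨ ∑-+ q (k * q) f ⟩
    ∑ q f + (∑[ i < k * q ] f (q + i))                        ≡⟨ cong₂ _+_ firstBlock (∑-cong (k * q) (λ i _ → shift i)) ⟩
    h 0 + (∑[ i < k * q ] when (does (q ∣? i)) (h (q + i)))   ≡⟨ cong (h 0 +_) (∑-multiples q k (h ∘ (q +_))) ⟩
    h 0 + (∑[ b < k ] h (q + b * q))                          ∎
    where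
    open ≡-Reasoning
    f : ℕ → ℕ
    f a = when (does (q ∣? a)) (h a)
    firstBlock : ∑ q f ≡ h 0
    firstBlock = begin
      f 0 + ∑ q′ (f ∘ suc)   ≡⟨ cong₂ _+_ (cong (λ b → when b (h 0)) (dec-true (q ∣? 0) (q ∣0))) (∑-zero q′ (f ∘ suc) below-q) ⟩
      h 0 + 0                ≡⟨ +-identityʳ (h 0) ⟩
      h 0                    ∎
      where
      below-q : ∀ a → a < q′ → f (suc a) ≡ 0
      below-q a a<q′ = cong (λ b → when b (h (suc a))) (dec-false (q ∣? suc a) (λ q∣ → <⇒≱ (s<s a<q′) (∣⇒≤ q∣)))
    shift : ∀ i → f (q + i) ≡ when (does (q ∣? i)) (h (q + i))
    shift i = cong (λ b → when b (h (q + i)))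
                   (does-⇔ (mk⇔ (λ q∣q+i → ∣m+n∣m⇒∣n q∣q+i ∣-refl) (∣m∣n⇒∣m+n ∣-refl)) (q ∣? (q + i)) (q ∣? i))

module Counting where

  open import Defs using (vectors)
  open import Data.Bool using (Bool; true; false; _∧_; not; if_then_else_; T)
  open import Data.Bool.Properties using (T-∧; T-not-≡)
  open import Data.Nat using (ℕ; zero; suc; _+_; _*_; _^_; _≤_; _<_; z≤n; s≤s)
  open import Data.Nat.Properties using (+-suc; +-mono-≤; m≤n⇒m≤1+n; ≤-refl; ≤-reflexive; module ≤-Reasoning)
  open import Data.List using (List; []; _∷_; _++_; map; length; filterᵇ; concatMap; applyUpTo)
  open import Data.Vec using (Vec; []; _∷_)
  open import Data.Product using (Σ-syntax; _×_; _,_; proj₂)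
  open import Data.Empty using (⊥; ⊥-elim)
  open import Data.Unit using (tt)
  open import Function using (_∘_; id; Equivalence)
  open import Relation.Nullary using (¬_)
  open import Relation.Binary.PropositionalEquality using (_≡_; refl; sym; trans; cong; cong₂; subst)
  open FiniteSums

  private variable A B : Set

  count : (A → Bool) → List A → ℕ
  count p []       = 0
  count p (x ∷ xs) = if p x then suc (count p xs) else count p xs

  length-filterᵇ : (p : A → Bool) (xs : List A) → length (filterᵇ p xs) ≡ count p xs
  length-filterᵇ p []       = refl
  length-filterᵇ p (x ∷ xs) with p x
  ... | true  = cong suc (length-filterᵇ p xs)
  ... | false = length-filterᵇ p xs

  count-++ : (p : A → Bool) (xs ys : List A) → count p (xs ++ ys) ≡ count p xs + count p ys
  count-++ p []       ys = refl
  count-++ p (x ∷ xs) ys with p x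
  ... | true  = cong suc (count-++ p xs ys)
  ... | false = count-++ p xs ys

  count-map : (p : B → Bool) (f : A → B) (xs : List A) → count p (map f xs) ≡ count (p ∘ f) xs
  count-map p f []       = refl
  count-map p f (x ∷ xs) with p (f x)
  ... | true  = cong suc (count-map p f xs)
  ... | false = count-map p f xs

  count-concatMap-applyUpTo : (p : B → Bool) (h : A → List B) (f : ℕ → A) (n : ℕ) →
                              count p (concatMap h (applyUpTo f n)) ≡ ∑[ a < n ] count p (h (f a))
  count-concatMap-applyUpTo p h f zero    = refl
  count-concatMap-applyUpTo p h f (suc n) =
    trans (count-++ p (h (f 0)) _) (cong (count p (h (f 0)) +_) (count-concatMap-applyUpTo p h (f ∘ suc) n))

  count-cong : {p q : A → Bool} → (∀ x → p x ≡ q x) → (xs : List A) → count p xs ≡ count q xs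
  count-cong p≗q []       = refl
  count-cong p≗q (x ∷ xs) = cong₂ (λ b n → if b then suc n else n) (p≗q x) (count-cong p≗q xs)

  count-none : {p : A → Bool} → (∀ x → ¬ T (p x)) → (xs : List A) → count p xs ≡ 0
  count-none never []       = refl
  count-none {p = p} never (x ∷ xs) with p x | never x
  ... | true  | never-x = ⊥-elim (never-x tt)
  ... | false | _       = count-none never xs

  count-∧-const : (b : Bool) (q : A → Bool) (xs : List A) → count (λ x → b ∧ q x) xs ≡ when b (count q xs)
  count-∧-const true  q xs = refl
  count-∧-const false q xs = count-none (λ _ ()) xs

  count-mono : {p q : A → Bool} → (∀ x → T (p x) → T (q x)) → (xs : List A) → count p xs ≤ count q xs
  count-mono p⇒q []       = z≤n
  count-mono {p = p} {q} p⇒q (x ∷ xs) with p x | q x | p⇒q x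
  ... | true  | true  | _   = s≤s (count-mono p⇒q xs)
  ... | true  | false | p⇒q = ⊥-elim (p⇒q tt)
  ... | false | true  | _   = m≤n⇒m≤1+n (count-mono p⇒q xs)
  ... | false | false | _   = count-mono p⇒q xs

  count-split : (p q : A → Bool) (xs : List A) →
                count p xs ≡ count (λ x → p x ∧ q x) xs + count (λ x → p x ∧ not (q x)) xs
  count-split p q []       = refl
  count-split p q (x ∷ xs) with p x | q x
  ... | true  | true  = cong suc (count-split p q xs)
  ... | true  | false = trans (cong suc (count-split p q xs)) (sym (+-suc _ _))
  ... | false | _     = count-split p q xs

  count-disjoint-≤ : {a b r : A → Bool} → (∀ x → T (a x) → T (r x)) → (∀ x → T (b x) → T (r x)) →
                     (∀ x → T (a x) → T (b x) → ⊥) → (xs : List A) → count a xs + count b xs ≤ count r xs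
  count-disjoint-≤ {a = a} {b} {r} a⇒r b⇒r disjoint xs = begin
    count a xs + count b xs                                        ≤⟨ +-mono-≤ (count-mono a⇒r∧a xs) (count-mono b⇒r∧¬a xs) ⟩
    count (λ x → r x ∧ a x) xs + count (λ x → r x ∧ not (a x)) xs  ≡⟨ count-split r a xs ⟨
    count r xs                                                     ∎
    where
    open ≤-Reasoning
    a⇒r∧a : ∀ x → T (a x) → T (r x ∧ a x)
    a⇒r∧a x ax = Equivalence.from T-∧ (a⇒r x ax , ax)
    b⇒r∧¬a : ∀ x → T (b x) → T (r x ∧ not (a x))
    b⇒r∧¬a x bx = Equivalence.from T-∧ (b⇒r x bx , ¬a)
      where
      ¬a : T (not (a x))
      ¬a with a x | disjoint x
      ... | true  | a∧b⇒⊥ = a∧b⇒⊥ tt bx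
      ... | false | _     = tt

  count-union-≤ : (p : A → Bool) (R : ℕ → A → Bool) (K : ℕ) → (∀ x → T (p x) → Σ[ j ∈ ℕ ] j < K × T (R j x)) →
                  (xs : List A) → count p xs ≤ ∑[ j < K ] count (R j) xs
  count-union-≤ p R zero    covered xs = ≤-reflexive (count-none (λ x px → uncovered (covered x px)) xs)
    where
    uncovered : ∀ {x} → ¬ (Σ[ j ∈ ℕ ] j < 0 × T (R j x))
    uncovered ()
  count-union-≤ p R (suc K) covered xs = begin
    count p xs
      ≡⟨ count-split p (R 0) xs ⟩
    count (λ x → p x ∧ R 0 x) xs + count (λ x → p x ∧ not (R 0 x)) xs
      ≤⟨ +-mono-≤ (count-mono (λ _ → proj₂ ∘ Equivalence.to T-∧) xs) (count-union-≤ _ (R ∘ suc) K coveredLater xs) ⟩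
    count (R 0) xs + (∑[ j < K ] count (R (suc j)) xs)
      ∎
    where
    open ≤-Reasoning
    coveredLater : ∀ x → T (p x ∧ not (R 0 x)) → Σ[ j ∈ ℕ ] j < K × T (R (suc j) x)
    coveredLater x p∧¬R₀ with Equivalence.to T-∧ p∧¬R₀
    ... | px , ¬R₀ with covered x px
    ... | zero  , _       , R₀ = ⊥-elim (subst T (Equivalence.to T-not-≡ ¬R₀) R₀)
    ... | suc j , s≤s j<K , Rⱼ = j , j<K , Rⱼ

  count-vectors-suc : ∀ d n (P : Vec ℕ (suc d) → Bool) →
                      count P (vectors (suc d) n) ≡ ∑[ a < n ] count (λ v → P (a ∷ v)) (vectors d n)
  count-vectors-suc d n P = trans (count-concatMap-applyUpTo P (λ a → map (a ∷_) (vectors d n)) id n)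
                                  (∑-cong n (λ a _ → count-map P (a ∷_) (vectors d n)))

  count-vectors-≤ : ∀ d n (P : Vec ℕ d → Bool) → count P (vectors d n) ≤ n ^ d
  count-vectors-≤ zero    n P with P []
  ... | true  = ≤-refl
  ... | false = z≤n
  count-vectors-≤ (suc d) n P = begin
    count P (vectors (suc d) n)                       ≡⟨ count-vectors-suc d n P ⟩
    ∑[ a < n ] count (λ v → P (a ∷ v)) (vectors d n)  ≤⟨ ∑-mono n (λ a _ → count-vectors-≤ d n (λ v → P (a ∷ v))) ⟩
    ∑[ _ < n ] n ^ d                                  ≡⟨ ∑-const n (n ^ d) ⟩
    n * n ^ d                                         ∎
    where open ≤-Reasoning

module Binomial where

  open import Data.Nat
  open import Data.Nat.Properties
  open import Data.Nat.Tactic.RingSolver using (solve-∀)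
  open import Relation.Binary.PropositionalEquality using (_≡_)

  binomial-upper : ∀ a b k → (a + b) ^ suc k ≤ a ^ suc k + suc k * b * (a + b) ^ k
  binomial-upper a b zero    = ≤-reflexive (linear a b)
    where
    linear : ∀ a b → (a + b) * 1 ≡ a * 1 + 1 * b * 1
    linear = solve-∀
  binomial-upper a b (suc k) = begin
    (a + b) * (a + b) ^ suc k                                 ≤⟨ *-monoʳ-≤ (a + b) (binomial-upper a b k) ⟩
    (a + b) * (a ^ suc k + suc k * b * (a + b) ^ k)           ≡⟨ expand a b k (a ^ suc k) ((a + b) ^ k) ⟩
    a ^ suc (suc k) + b * a ^ suc k + suc k * b * (a + b) ^ suc k
      ≤⟨ +-monoˡ-≤ (suc k * b * (a + b) ^ suc k) (+-monoʳ-≤ (a ^ suc (suc k)) (*-monoʳ-≤ b (^-monoˡ-≤ (suc k) (m≤m+n a b)))) ⟩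
    a ^ suc (suc k) + b * (a + b) ^ suc k + suc k * b * (a + b) ^ suc k
                                                              ≡⟨ collect (a ^ suc (suc k)) b k ((a + b) ^ suc k) ⟩
    a ^ suc (suc k) + suc (suc k) * b * (a + b) ^ suc k       ∎
    where
    open ≤-Reasoning
    expand : ∀ a b k X Y → (a + b) * (X + (1 + k) * b * Y) ≡ a * X + b * X + (1 + k) * b * ((a + b) * Y)
    expand = solve-∀
    collect : ∀ A b k Z → A + b * Z + (1 + k) * b * Z ≡ A + (2 + k) * b * Z
    collect = solve-∀

  binomial-lower : ∀ a b k → a ^ suc k + suc k * b * a ^ k ≤ (a + b) ^ suc k
  binomial-lower a b zero    = ≤-reflexive (linear a b)
    where
    linear : ∀ a b → a * 1 + 1 * b * 1 ≡ (a + b) * 1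
    linear = solve-∀
  binomial-lower a b (suc k) = begin
    a ^ suc (suc k) + suc (suc k) * b * a ^ suc k                     ≤⟨ m≤m+n _ (suc k * b * b * a ^ k) ⟩
    a ^ suc (suc k) + suc (suc k) * b * a ^ suc k + suc k * b * b * a ^ k
                                                                      ≡⟨ factor a b k (a ^ k) ⟩
    (a + b) * (a ^ suc k + suc k * b * a ^ k)                         ≤⟨ *-monoʳ-≤ (a + b) (binomial-lower a b k) ⟩
    (a + b) * (a + b) ^ suc k                                         ∎
    where
    open ≤-Reasoning
    factor : ∀ a b k X → a * (a * X) + (2 + k) * b * (a * X) + (1 + k) * b * b * X ≡ (a + b) * (a * X + (1 + k) * b * X)
    factor = solve-∀

module Simplex where

  open import Defs using (vectors)
  open import Data.Bool using (Bool; true; false; _∧_; T)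
  open import Data.Bool.Properties using (∧-zeroʳ; T-∧; T-≡)
  open import Data.Nat
  open import Data.Nat.Properties
  open import Data.Nat.Divisibility using (_∣_; _∣?_; 1∣_)
  open import Data.Vec using (Vec; []; _∷_; sum)
  open import Data.Vec.Relation.Unary.All as Vecₐ using ([]; _∷_)
  open import Data.Product using (_×_; _,_)
  open import Function using (_∘_; mk⇔; Equivalence)
  open import Relation.Nullary.Decidable using (Dec; yes; no; does; dec-true; dec-false; does-⇔)
  open import Relation.Binary.PropositionalEquality
  open import Data.Nat.Tactic.RingSolver using (solve-∀)
  open FiniteSums
  open Counting
  open Binomial

  isStep : ℕ → ℕ → ℕ → Bool
  isStep q m a = does (1 ≤? a) ∧ does (a ≤? m) ∧ does (q ∣? a)

  inSimplex : ℕ → ℕ → ∀ {d} → Vec ℕ d → Bool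
  inSimplex q m []      = true
  inSimplex q m (a ∷ v) = isStep q m a ∧ inSimplex q (m ∸ a) v

  isStep-beyond : ∀ q {m a} → m < a → isStep q m a ≡ false
  isStep-beyond q {m} {a} m<a =
    trans (cong (λ c → does (1 ≤? a) ∧ c ∧ does (q ∣? a)) (dec-false (a ≤? m) (<⇒≱ m<a))) (∧-zeroʳ _)

  simplexCount : (n q d m : ℕ) → ℕ
  simplexCount n q d m = count (inSimplex q m) (vectors d n)

  simplexCount-suc : ∀ n q d m → simplexCount n q (suc d) m ≡ ∑[ a < n ] when (isStep q m a) (simplexCount n q d (m ∸ a))
  simplexCount-suc n q d m = trans (count-vectors-suc d n (inSimplex q m))
    (∑-cong n (λ a _ → count-∧-const (isStep q m a) (inSimplex q (m ∸ a)) (vectors d n)))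

  private
    witness : {P : Set} (p? : Dec P) → T (does p?) → P
    witness (yes p) _ = p

    does-T : {P : Set} (p? : Dec P) → P → T (does p?)
    does-T p? p = Equivalence.from T-≡ (dec-true p? p)

  inSimplex-head : ∀ q m a {d} (v : Vec ℕ d) → T (inSimplex q m (a ∷ v)) →
                   (1 ≤ a × a ≤ m × q ∣ a) × T (inSimplex q (m ∸ a) v)
  inSimplex-head q m a v h with Equivalence.to T-∧ h
  ... | step , rest with Equivalence.to T-∧ step
  ... | 1≤a , step′ with Equivalence.to T-∧ step′
  ... | a≤m , q∣a = (witness (1 ≤? a) 1≤a , witness (a ≤? m) a≤m , witness (q ∣? a) q∣a) , rest

  inSimplex-sum : ∀ q m {d} (v : Vec ℕ d) → T (inSimplex q m v) → sum v ≤ m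
  inSimplex-sum q m []      _ = z≤n
  inSimplex-sum q m (a ∷ v) h with inSimplex-head q m a v h
  ... | (_ , a≤m , _) , rest = subst (a + sum v ≤_) (m+[n∸m]≡n a≤m) (+-monoʳ-≤ a (inSimplex-sum q (m ∸ a) v rest))

  inSimplex-positive : ∀ q m {d} (v : Vec ℕ d) → T (inSimplex q m v) → Vecₐ.All (1 ≤_) v
  inSimplex-positive q m []      _ = []
  inSimplex-positive q m (a ∷ v) h with inSimplex-head q m a v h
  ... | (1≤a , _) , rest = 1≤a ∷ inSimplex-positive q (m ∸ a) v rest

  inSimplex-coarsen : ∀ q {m d} (v : Vec ℕ d) → T (inSimplex 1 m v) → Vecₐ.All (q ∣_) v → T (inSimplex q m v)
  inSimplex-coarsen q         []      _ _            = _
  inSimplex-coarsen q {m} (a ∷ v) h (q∣a ∷ q∣v) with inSimplex-head 1 m a v h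
  ... | (1≤a , a≤m , _) , rest = Equivalence.from T-∧
    (Equivalence.from T-∧ (does-T (1 ≤? a) 1≤a , Equivalence.from T-∧ (does-T (a ≤? m) a≤m , does-T (q ∣? a) q∣a)) ,
     inSimplex-coarsen q v rest q∣v)

  module _ (q e : ℕ) where

    multiplesPowerSum : ℕ → ℕ → ℕ
    multiplesPowerSum k m = ∑[ b < k ] when (does (suc b * q ≤? m)) ((m ∸ suc b * q) ^ e)

    -- A Riemann sum: q · Σ_{b ≥ 1, bq ≤ m} (m - bq)^e ≤ ∫₀^m x^e dx.
    multiplesPowerSum-≤ : ∀ k m → suc e * q * multiplesPowerSum k m ≤ m ^ suc e
    multiplesPowerSum-≤ zero    m = ≤-trans (≤-reflexive (*-zeroʳ (suc e * q))) z≤n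
    multiplesPowerSum-≤ (suc k) m with q ≤? m
    ... | no  q≰m = ≤-trans (≤-reflexive (trans (cong (suc e * q *_) allZero) (*-zeroʳ (suc e * q)))) z≤n
      where
      allZero : multiplesPowerSum (suc k) m ≡ 0
      allZero = ∑-zero (suc k) _ (λ b _ → cong (λ c → when c ((m ∸ suc b * q) ^ e)) (dec-false (suc b * q ≤? m) (q≰m ∘ m+n≤o⇒m≤o q)))
    ... | yes q≤m = begin
      suc e * q * multiplesPowerSum (suc k) m             ≡⟨ cong (suc e * q *_) peel ⟩
      suc e * q * (m′ ^ e + multiplesPowerSum k m′)       ≡⟨ *-distribˡ-+ (suc e * q) _ _ ⟩
      suc e * q * m′ ^ e + suc e * q * multiplesPowerSum k m′
                                                          ≤⟨ +-monoʳ-≤ _ (multiplesPowerSum-≤ k m′) ⟩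
      suc e * q * m′ ^ e + m′ ^ suc e                     ≡⟨ +-comm _ (m′ ^ suc e) ⟩
      m′ ^ suc e + suc e * q * m′ ^ e                     ≤⟨ binomial-lower m′ q e ⟩
      (m′ + q) ^ suc e                                    ≡⟨ cong (_^ suc e) (m∸n+n≡m q≤m) ⟩
      m ^ suc e                                           ∎
      where
      open ≤-Reasoning
      m′ : ℕ
      m′ = m ∸ q
      shift : ∀ x → when (does (q + x ≤? m)) ((m ∸ (q + x)) ^ e) ≡ when (does (x ≤? m′)) ((m′ ∸ x) ^ e)
      shift x = cong₂ when
        (does-⇔ (mk⇔ (λ q+x≤m → m+n≤o⇒m≤o∸n x (subst (_≤ m) (+-comm q x) q+x≤m))
                     (λ x≤m′ → subst₂ _≤_ (+-comm x q) (m∸n+n≡m q≤m) (+-monoˡ-≤ q x≤m′)))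
                (q + x ≤? m) (x ≤? m′))
        (cong (_^ e) (sym (∸-+-assoc m q x)))
      peel : multiplesPowerSum (suc k) m ≡ m′ ^ e + multiplesPowerSum k m′
      peel = ∑-cong (suc k) (λ b _ → shift (b * q))

  simplexStepSum-≤ : ∀ q .{{_ : NonZero q}} e m n → suc e * q * (∑[ a < n ] when (isStep q m a) ((m ∸ a) ^ e)) ≤ m ^ suc e
  simplexStepSum-≤ q@(suc _) e m n = begin
    suc e * q * ∑ n f                                                    ≤⟨ *-monoʳ-≤ (suc e * q) (∑-mono-range f (m≤m*n n q)) ⟩
    suc e * q * ∑ (n * q) f                                              ≡⟨ cong (suc e * q *_) (∑-cong (n * q) (λ a _ → rotate a)) ⟩
    suc e * q * (∑[ a < n * q ] when (does (q ∣? a)) (positiveTerm a))   ≡⟨ cong (suc e * q *_) (∑-multiples q n positiveTerm) ⟩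
    suc e * q * (∑[ b < n ] positiveTerm (b * q))                        ≤⟨ dropZero n ⟩
    m ^ suc e                                                            ∎
    where
    open ≤-Reasoning
    f : ℕ → ℕ
    f a = when (isStep q m a) ((m ∸ a) ^ e)
    positiveTerm : ℕ → ℕ
    positiveTerm a = when (does (1 ≤? a) ∧ does (a ≤? m)) ((m ∸ a) ^ e)
    rotate : ∀ a → f a ≡ when (does (q ∣? a)) (positiveTerm a)
    rotate a = when-∧-rotate (does (1 ≤? a)) (does (a ≤? m)) (does (q ∣? a)) ((m ∸ a) ^ e)
    dropZero : ∀ n → suc e * q * (∑[ b < n ] positiveTerm (b * q)) ≤ m ^ suc e
    dropZero zero    = ≤-trans (≤-reflexive (*-zeroʳ (suc e * q))) z≤n
    dropZero (suc k) = multiplesPowerSum-≤ q e k m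

  simplexCount-upper : ∀ n q .{{_ : NonZero q}} d m → d ! * q ^ d * simplexCount n q d m ≤ m ^ d
  simplexCount-upper n q zero    m = ≤-refl
  simplexCount-upper n q (suc d) m = begin
    suc d ! * q ^ suc d * simplexCount n q (suc d) m
      ≡⟨ cong (suc d ! * q ^ suc d *_) (simplexCount-suc n q d m) ⟩
    (suc d * d !) * (q * q ^ d) * ∑ n term
      ≡⟨ regroup (suc d) (d !) q (q ^ d) (∑ n term) ⟩
    suc d * q * (d ! * q ^ d * ∑ n term)
      ≡⟨ cong (suc d * q *_) (*-distribˡ-∑ (d ! * q ^ d) n term) ⟩
    suc d * q * (∑[ a < n ] d ! * q ^ d * term a)
      ≤⟨ *-monoʳ-≤ (suc d * q) (∑-mono n (λ a _ → induction a)) ⟩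
    suc d * q * (∑[ a < n ] when (isStep q m a) ((m ∸ a) ^ d))
      ≤⟨ simplexStepSum-≤ q d m n ⟩
    m ^ suc d
      ∎
    where
    open ≤-Reasoning
    term : ℕ → ℕ
    term a = when (isStep q m a) (simplexCount n q d (m ∸ a))
    induction : ∀ a → d ! * q ^ d * term a ≤ when (isStep q m a) ((m ∸ a) ^ d)
    induction a = ≤-trans (≤-reflexive (*-when (d ! * q ^ d) (isStep q m a) _))
                          (when-mono (isStep q m a) (simplexCount-upper n q d (m ∸ a)))
    regroup : ∀ s f q Q S → (s * f) * (q * Q) * S ≡ s * q * (f * Q * S)
    regroup = solve-∀

  simplexCount-upper² : ∀ n q .{{_ : NonZero q}} d m → 2 ≤ d → q * q * (d ! * simplexCount n q d m) ≤ m ^ d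
  simplexCount-upper² n q 1 m (s≤s ())
  simplexCount-upper² n q d@(suc (suc e)) m _ = begin
    q * q * (d ! * C)           ≡⟨ regroup q (d !) C ⟩
    d ! * (q * (q * 1)) * C     ≤⟨ *-monoˡ-≤ C (*-monoʳ-≤ (d !) (*-monoʳ-≤ q (*-monoʳ-≤ q (m^n>0 q e)))) ⟩
    d ! * q ^ d * C             ≤⟨ simplexCount-upper n q d m ⟩
    m ^ d                       ∎
    where
    open ≤-Reasoning
    C : ℕ
    C = simplexCount n q d m
    regroup : ∀ q F C → q * q * (F * C) ≡ F * (q * (q * 1)) * C
    regroup = solve-∀

  pow-suc∸-≤ : ∀ e m → (suc m ∸ e) ^ suc e ≤ (m ∸ e) ^ suc e + suc e * (suc m ∸ e) ^ e
  pow-suc∸-≤ e m with e ≤? m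
  ... | no  e≰m rewrite m≤n⇒m∸n≡0 (≰⇒> e≰m) = z≤n
  ... | yes e≤m = subst (λ x → x ^ suc e ≤ (m ∸ e) ^ suc e + suc e * x ^ e) (sym suc∸≡∸+1)
                        (subst (λ c → (m ∸ e + 1) ^ suc e ≤ (m ∸ e) ^ suc e + c * (m ∸ e + 1) ^ e)
                               (*-identityʳ (suc e)) (binomial-upper (m ∸ e) 1 e))
    where
    suc∸≡∸+1 : suc m ∸ e ≡ m ∸ e + 1
    suc∸≡∸+1 = trans (+-∸-assoc 1 e≤m) (+-comm 1 (m ∸ e))

  powerSum-lower : ∀ e m → (m ∸ e) ^ suc e ≤ suc e * (∑[ j < m ] (suc j ∸ e) ^ e)
  powerSum-lower e zero    rewrite 0∸n≡0 e = z≤n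
  powerSum-lower e (suc m) = begin
    (suc m ∸ e) ^ suc e                       ≤⟨ pow-suc∸-≤ e m ⟩
    (m ∸ e) ^ suc e + suc e * g m             ≤⟨ +-monoˡ-≤ (suc e * g m) (powerSum-lower e m) ⟩
    suc e * ∑ m g + suc e * g m               ≡⟨ *-distribˡ-+ (suc e) (∑ m g) (g m) ⟨
    suc e * (∑ m g + g m)                     ≡⟨ cong (suc e *_) (∑-last m g) ⟨
    suc e * ∑ (suc m) g                       ∎
    where
    open ≤-Reasoning
    g : ℕ → ℕ
    g j = (suc j ∸ e) ^ e

  ∑-simplexSteps : ∀ (f : ℕ → ℕ) {m n} → m < n → ∑[ a < n ] when (isStep 1 m a) (f (m ∸ a)) ≡ ∑ m f
  ∑-simplexSteps f {m} {n} m<n = begin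
    ∑ n g                        ≡⟨ ∑-truncate g m<n beyond ⟩
    ∑ (suc m) g                  ≡⟨ ∑-cong m (λ a a<m → inRange a a<m) ⟩
    ∑[ a < m ] f (m ∸ suc a)     ≡⟨ ∑-reverse m f ⟩
    ∑ m f                        ∎
    where
    open ≡-Reasoning
    g : ℕ → ℕ
    g a = when (isStep 1 m a) (f (m ∸ a))
    beyond : ∀ a → m < a → g a ≡ 0
    beyond a m<a = cong (λ c → when c (f (m ∸ a))) (isStep-beyond 1 m<a)
    inRange : ∀ a → a < m → g (suc a) ≡ f (m ∸ suc a)
    inRange a a<m = cong (λ c → when c (f (m ∸ suc a))) (cong₂ _∧_ (dec-true (suc a ≤? m) a<m) (dec-true (1 ∣? suc a) (1∣ suc a)))

  simplexCount-lower : ∀ n d m → m < n → (suc m ∸ d) ^ d ≤ d ! * simplexCount n 1 d m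
  simplexCount-lower n zero    m m<n = ≤-refl
  simplexCount-lower n (suc d) m m<n = begin
    (m ∸ d) ^ suc d                                                 ≤⟨ powerSum-lower d m ⟩
    suc d * (∑[ j < m ] (suc j ∸ d) ^ d)                            ≤⟨ *-monoʳ-≤ (suc d) (∑-mono m induction) ⟩
    suc d * (∑[ j < m ] d ! * simplexCount n 1 d j)                 ≡⟨ cong (suc d *_) (*-distribˡ-∑ (d !) m _) ⟨
    suc d * (d ! * ∑ m (simplexCount n 1 d))                        ≡⟨ *-assoc (suc d) (d !) _ ⟨
    suc d ! * ∑ m (simplexCount n 1 d)                              ≡⟨ cong (suc d ! *_) (∑-simplexSteps (simplexCount n 1 d) m<n) ⟨
    suc d ! * (∑[ a < n ] when (isStep 1 m a) (simplexCount n 1 d (m ∸ a)))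
                                                                    ≡⟨ cong (suc d ! *_) (simplexCount-suc n 1 d m) ⟨
    suc d ! * simplexCount n 1 (suc d) m                            ∎
    where
    open ≤-Reasoning
    induction : ∀ j → j < m → (suc j ∸ d) ^ d ≤ d ! * simplexCount n 1 d j
    induction j j<m = simplexCount-lower n d j (<-trans j<m m<n)

module ZeroSumFree where

  open import Defs using (allSubsetSums; nonemptySubsetSums; zeroSumFree)
  open import Data.Bool using (T)
  open import Data.Bool.Properties using (T-not-≡)
  open import Data.Nat
  open import Data.Nat.Properties
  open import Data.Nat.Divisibility using (_∣_; _∣?_; _∣0; ∣⇒≤; ∣m+n∣m⇒∣n; ∣m∣n⇒∣m+n; ∣-refl)
  open import Data.List.Relation.Unary.All as Listₐ using ([]; _∷_)
  open import Data.List.Relation.Unary.All.Properties using (++⁺; map⁺; all⁻)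
  open import Data.Vec using (Vec; []; _∷_; sum; map)
  open import Data.Vec.Relation.Unary.All as Vecₐ using ([]; _∷_)
  open import Data.Product using (Σ-syntax; _×_; _,_)
  open import Function using (Equivalence)
  open import Relation.Nullary using (¬_)
  open import Relation.Nullary.Decidable using (dec-false)
  open import Relation.Binary.PropositionalEquality using (_≡_; refl; sym; cong₂; subst; module ≡-Reasoning)
  open import Data.Nat.Tactic.RingSolver using (solve-∀)

  private variable d n : ℕ

  neg : ℕ → Vec ℕ d → Vec ℕ d
  neg n = map (n ∸_)

  zeroSumFree-intro : (v : Vec ℕ d) → Listₐ.All (λ s → ¬ n ∣ s) (nonemptySubsetSums v) → T (zeroSumFree n v)
  zeroSumFree-intro {n = n} v no-multiple =
    all⁻ _ (Listₐ.map (λ {s} n∤s → Equivalence.from T-not-≡ (dec-false (n ∣? s) n∤s)) no-multiple)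

  allSubsetSums-≤ : (v : Vec ℕ d) → Listₐ.All (_≤ sum v) (allSubsetSums v)
  allSubsetSums-≤ []      = z≤n ∷ []
  allSubsetSums-≤ (x ∷ v) = ++⁺ (Listₐ.map (λ s≤ → ≤-trans s≤ (m≤n+m (sum v) x)) (allSubsetSums-≤ v))
                                (map⁺ (Listₐ.map (+-monoʳ-≤ x) (allSubsetSums-≤ v)))

  nonemptySubsetSums-bounds : (v : Vec ℕ d) → Vecₐ.All (1 ≤_) v →
                              Listₐ.All (λ s → 1 ≤ s × s ≤ sum v) (nonemptySubsetSums v)
  nonemptySubsetSums-bounds []      []           = []
  nonemptySubsetSums-bounds (x ∷ v) (1≤x ∷ 1≤v) =
    ++⁺ (Listₐ.map (λ (1≤s , s≤) → 1≤s , ≤-trans s≤ (m≤n+m (sum v) x)) (nonemptySubsetSums-bounds v 1≤v))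
        (map⁺ (Listₐ.map (λ s≤ → ≤-trans 1≤x (m≤m+n x _) , +-monoʳ-≤ x s≤) (allSubsetSums-≤ v)))

  zeroSumFree-small : (v : Vec ℕ d) → Vecₐ.All (1 ≤_) v → sum v < n → T (zeroSumFree n v)
  zeroSumFree-small v 1≤v sum<n = zeroSumFree-intro v
    (Listₐ.map (λ (1≤s , s≤) n∣s → <⇒≱ (≤-<-trans s≤ sum<n) (∣⇒≤ {{>-nonZero 1≤s}} n∣s))
               (nonemptySubsetSums-bounds v 1≤v))

  private
    complement-∣ : ∀ {x s u} → x ≤ n → n ∣ s + u → n ∣ (x + s) + (n ∸ x + u)
    complement-∣ {n} {x} {s} {u} x≤n n∣s+u =
      subst (n ∣_) (regroup x s (n ∸ x) u) (subst (λ m → n ∣ m + (s + u)) (sym (m+[n∸m]≡n x≤n)) (∣m∣n⇒∣m+n ∣-refl n∣s+u))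
      where
      regroup : ∀ x s y u → (x + y) + (s + u) ≡ (x + s) + (y + u)
      regroup = solve-∀

  -- u is the sum of the components of neg n v at the positions forming s.
  allSubsetSums-complement : (v : Vec ℕ d) → Vecₐ.All (_≤ n) v →
    Listₐ.All (λ s → Σ[ u ∈ ℕ ] n ∣ s + u × u ≤ sum (neg n v)) (allSubsetSums v)
  allSubsetSums-complement {n = n} []      []           = (0 , n ∣0 , z≤n) ∷ []
  allSubsetSums-complement {n = n} (x ∷ v) (x≤n ∷ v≤n) =
    ++⁺ (Listₐ.map (λ (u , n∣s+u , u≤) → u , n∣s+u , ≤-trans u≤ (m≤n+m _ (n ∸ x))) rest)
        (map⁺ (Listₐ.map (λ (u , n∣s+u , u≤) → n ∸ x + u , complement-∣ x≤n n∣s+u , +-monoʳ-≤ (n ∸ x) u≤) rest))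
    where
    rest : Listₐ.All (λ s → Σ[ u ∈ ℕ ] n ∣ s + u × u ≤ sum (neg n v)) (allSubsetSums v)
    rest = allSubsetSums-complement v v≤n

  nonemptySubsetSums-complement : (v : Vec ℕ d) → Vecₐ.All (_< n) v →
    Listₐ.All (λ s → Σ[ u ∈ ℕ ] n ∣ s + u × 1 ≤ u × u ≤ sum (neg n v)) (nonemptySubsetSums v)
  nonemptySubsetSums-complement         []      []           = []
  nonemptySubsetSums-complement {n = n} (x ∷ v) (x<n ∷ v<n) =
    ++⁺ (Listₐ.map (λ (u , n∣s+u , 1≤u , u≤) → u , n∣s+u , 1≤u , ≤-trans u≤ (m≤n+m _ (n ∸ x)))
                   (nonemptySubsetSums-complement v v<n))
        (map⁺ (Listₐ.map (λ (u , n∣s+u , u≤) → n ∸ x + u , complement-∣ (<⇒≤ x<n) n∣s+u ,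
                                                ≤-trans (m<n⇒0<n∸m x<n) (m≤m+n _ u) , +-monoʳ-≤ (n ∸ x) u≤)
                         (allSubsetSums-complement v (Vecₐ.map <⇒≤ v<n))))

  zeroSumFree-neg : (v : Vec ℕ d) → Vecₐ.All (_< n) v → sum (neg n v) < n → T (zeroSumFree n v)
  zeroSumFree-neg v v<n sum<n = zeroSumFree-intro v
    (Listₐ.map (λ (u , n∣s+u , 1≤u , u≤) n∣s → <⇒≱ (≤-<-trans u≤ sum<n) (∣⇒≤ {{>-nonZero 1≤u}} (∣m+n∣m⇒∣n n∣s+u n∣s)))
               (nonemptySubsetSums-complement v v<n))

  sum+sum-neg : (v : Vec ℕ d) → Vecₐ.All (_< n) v → sum v + sum (neg n v) ≡ d * n
  sum+sum-neg         []      []            = refl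
  sum+sum-neg {suc d} {n} (x ∷ v) (x<n ∷ v<n) = begin
    x + sum v + (n ∸ x + sum (neg n v))          ≡⟨ regroup x (sum v) (n ∸ x) (sum (neg n v)) ⟩
    (x + (n ∸ x)) + (sum v + sum (neg n v))      ≡⟨ cong₂ _+_ (m+[n∸m]≡n (<⇒≤ x<n)) (sum+sum-neg v v<n) ⟩
    n + d * n                                    ∎
    where
    open ≡-Reasoning
    regroup : ∀ x s y t → x + s + (y + t) ≡ (x + y) + (s + t)
    regroup = solve-∀

  neg-positive⇒< : (v : Vec ℕ d) → Vecₐ.All (1 ≤_) (neg n v) → Vecₐ.All (_< n) v
  neg-positive⇒< []      []             = []
  neg-positive⇒< (x ∷ v) (1≤n∸x ∷ rest) = ≰⇒> (λ n≤x → <⇒≱ 1≤n∸x (≤-reflexive (m≤n⇒m∸n≡0 n≤x))) ∷ neg-positive⇒< v rest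

module CommonDivisors where

  open import Defs using (gcdWithIsOne)
  open import Data.Bool using (T)
  open import Data.Nat
  open import Data.Nat.Properties
  open import Data.Nat.GCD using (gcd; gcd[m,n]∣m; gcd[m,n]∣n; gcd-greatest)
  open import Data.Nat.Divisibility using (_∣_; divides; ∣⇒≤; ∣m+n∣m⇒∣n; ∣-refl; ∣-trans; ∣-reflexive; ∣1⇒≡1; 0∣⇒≡0)
  open import Data.Vec using (Vec; []; _∷_; foldr)
  open import Data.Vec.Relation.Unary.All as Vecₐ using ([]; _∷_)
  open import Data.Product using (Σ-syntax; _×_; _,_)
  open import Data.Sum using (_⊎_; inj₁; inj₂)
  open import Data.Empty using (⊥-elim)
  open import Relation.Nullary using (¬_)
  open import Relation.Binary.PropositionalEquality using (_≡_; _≢_; refl; sym; cong; subst)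
  open ZeroSumFree using (neg)

  private variable d n : ℕ

  gcdVec : ℕ → Vec ℕ d → ℕ
  gcdVec n = foldr (λ _ → ℕ) gcd n

  gcdVec∣n : (v : Vec ℕ d) → gcdVec n v ∣ n
  gcdVec∣n []      = ∣-refl
  gcdVec∣n (x ∷ v) = ∣-trans (gcd[m,n]∣n x _) (gcdVec∣n v)

  gcdVec∣components : (v : Vec ℕ d) → Vecₐ.All (gcdVec n v ∣_) v
  gcdVec∣components []      = []
  gcdVec∣components (x ∷ v) = gcd[m,n]∣m x _ ∷ Vecₐ.map (∣-trans (gcd[m,n]∣n x _)) (gcdVec∣components v)

  gcdVec-greatest : ∀ {c} (v : Vec ℕ d) → c ∣ n → Vecₐ.All (c ∣_) v → c ∣ gcdVec n v
  gcdVec-greatest []      c∣n []            = c∣n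
  gcdVec-greatest (x ∷ v) c∣n (c∣x ∷ c∣v) = gcd-greatest c∣x (gcdVec-greatest v c∣n c∣v)

  gcdWithIsOne-neg : (v : Vec ℕ d) → Vecₐ.All (_< n) v → T (gcdWithIsOne n (neg n v)) → T (gcdWithIsOne n v)
  gcdWithIsOne-neg {n = n} v v<n coprime = ≡⇒≡ᵇ (gcdVec n v) 1 (∣1⇒≡1 g∣1)
    where
    g : ℕ
    g = gcdVec n v
    g∣neg : ∀ {d} (w : Vec ℕ d) → Vecₐ.All (_< n) w → Vecₐ.All (g ∣_) w → Vecₐ.All (g ∣_) (neg n w)
    g∣neg []      []            []            = []
    g∣neg (x ∷ w) (x<n ∷ w<n) (g∣x ∷ g∣w) =
      ∣m+n∣m⇒∣n (subst (g ∣_) (sym (m+[n∸m]≡n (<⇒≤ x<n))) (gcdVec∣n v)) g∣x ∷ g∣neg w w<n g∣w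
    g∣1 : g ∣ 1
    g∣1 = subst (g ∣_) (≡ᵇ⇒≡ _ 1 coprime) (gcdVec-greatest (neg n v) (gcdVec∣n v) (g∣neg v v<n (gcdVec∣components v)))

  -- Every g ≥ 2 has a divisor among 2, 3, 5, 7, 9, …, and the sum of their inverse squares is below 1/2.
  modulus : ℕ → ℕ
  modulus zero    = 2
  modulus (suc j) = 3 + j * 2

  modulus-nonZero : ∀ j → NonZero (modulus j)
  modulus-nonZero zero    = _
  modulus-nonZero (suc j) = _

  private
    even⊎odd : ∀ g → (Σ[ h ∈ ℕ ] g ≡ h * 2) ⊎ (Σ[ h ∈ ℕ ] g ≡ suc (h * 2))
    even⊎odd zero    = inj₁ (0 , refl)
    even⊎odd (suc g) with even⊎odd g
    ... | inj₁ (h , g≡2h)   = inj₂ (h , cong suc g≡2h)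
    ... | inj₂ (h , g≡2h+1) = inj₁ (suc h , cong suc g≡2h+1)

  modulus-divisor : ∀ g → 2 ≤ g → Σ[ j ∈ ℕ ] j < g × modulus j ∣ g
  modulus-divisor g 2≤g with even⊎odd g
  ... | inj₁ (h , g≡2h)             = 0 , <-trans z<s 2≤g , divides h g≡2h
  ... | inj₂ (zero , g≡1)           = ⊥-elim (<⇒≱ ≤-refl (subst (2 ≤_) g≡1 2≤g))
  ... | inj₂ (suc j , g≡2[1+j]+1)   = suc j , subst (suc j <_) (sym g≡2[1+j]+1) (s≤s (m≤m*n (suc j) 2)) , ∣-reflexive (sym g≡2[1+j]+1)

  private
    g≢0⇒g≢1⇒2≤g : ∀ {g} → g ≢ 0 → g ≢ 1 → 2 ≤ g
    g≢0⇒g≢1⇒2≤g {zero}          g≢0 _   = ⊥-elim (g≢0 refl)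
    g≢0⇒g≢1⇒2≤g {suc zero}      _   g≢1 = ⊥-elim (g≢1 refl)
    g≢0⇒g≢1⇒2≤g {suc (suc _)}   _   _   = s≤s (s≤s z≤n)

  nonCoprime⇒commonModulus : .{{_ : NonZero n}} (v : Vec ℕ d) → ¬ T (gcdWithIsOne n v) →
                             Σ[ j ∈ ℕ ] j < n × Vecₐ.All (modulus j ∣_) v
  nonCoprime⇒commonModulus {n = n} v notCoprime =
    let j , j<g , mⱼ∣g = modulus-divisor g (g≢0⇒g≢1⇒2≤g g≢0 g≢1)
    in  j , <-≤-trans j<g (∣⇒≤ (gcdVec∣n v)) , Vecₐ.map (∣-trans mⱼ∣g) (gcdVec∣components v)
    where
    g : ℕ
    g = gcdVec n v
    g≢0 : g ≢ 0
    g≢0 g≡0 = ≢-nonZero⁻¹ n (0∣⇒≡0 (subst (_∣ n) g≡0 (gcdVec∣n v)))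
    g≢1 : g ≢ 1
    g≢1 g≡1 = notCoprime (≡⇒≡ᵇ g 1 g≡1)

module Symmetry where

  open import Defs using (vectors)
  open import Data.Bool using (Bool; _∧_)
  open import Data.Bool.Properties using (∧-assoc)
  open import Data.Nat
  open import Data.Nat.Properties using (m∸n≤m; ≤-<-trans)
  open import Data.Vec using (Vec; _∷_)
  open import Data.List using (List)
  open import Relation.Binary.PropositionalEquality
  open FiniteSums
  open Counting
  open Simplex
  open ZeroSumFree using (neg)

  private
    count-∧-const-assoc : ∀ {A : Set} b (p r : A → Bool) (xs : List A) →
                          count (λ x → (b ∧ p x) ∧ r x) xs ≡ when b (count (λ x → p x ∧ r x) xs)
    count-∧-const-assoc b p r xs = trans (count-cong (λ x → ∧-assoc b (p x) (r x)) xs) (count-∧-const b _ xs)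

  -- neg n permutes the vectors with entries in 1, …, n-1, and only those lie in the simplex when m < n.
  count-simplex-neg : ∀ n d m (Q : Vec ℕ d → Bool) → m < n →
    count (λ v → inSimplex 1 m (neg n v) ∧ Q (neg n v)) (vectors d n) ≡ count (λ v → inSimplex 1 m v ∧ Q v) (vectors d n)
  count-simplex-neg n zero    m Q m<n = refl
  count-simplex-neg n (suc d) m Q m<n = begin
    count (λ v → inSimplex 1 m (neg n v) ∧ Q (neg n v)) (vectors (suc d) n)
      ≡⟨ count-vectors-suc d n _ ⟩
    (∑[ a < n ] count (λ w → (isStep 1 m (n ∸ a) ∧ inSimplex 1 (m ∸ (n ∸ a)) (neg n w)) ∧ Q ((n ∸ a) ∷ neg n w)) (vectors d n))
      ≡⟨ ∑-cong n (λ a _ → trans (count-∧-const-assoc (isStep 1 m (n ∸ a)) _ _ (vectors d n))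
                                 (cong (when (isStep 1 m (n ∸ a))) (induction (n ∸ a)))) ⟩
    (∑[ a < n ] tail (n ∸ a))
      ≡⟨ ∑-reflect n tail refl (cong (λ c → when c (tailCount n)) (isStep-beyond 1 m<n)) ⟩
    ∑ n tail
      ≡⟨ ∑-cong n (λ a _ → count-∧-const-assoc (isStep 1 m a) _ _ (vectors d n)) ⟨
    (∑[ a < n ] count (λ w → (isStep 1 m a ∧ inSimplex 1 (m ∸ a) w) ∧ Q (a ∷ w)) (vectors d n))
      ≡⟨ count-vectors-suc d n _ ⟨
    count (λ v → inSimplex 1 m v ∧ Q v) (vectors (suc d) n)
      ∎
    where
    open ≡-Reasoning
    tailCount : ℕ → ℕ
    tailCount b = count (λ w → inSimplex 1 (m ∸ b) w ∧ Q (b ∷ w)) (vectors d n)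
    tail : ℕ → ℕ
    tail b = when (isStep 1 m b) (tailCount b)
    induction : ∀ b → count (λ w → inSimplex 1 (m ∸ b) (neg n w) ∧ Q (b ∷ neg n w)) (vectors d n)
                    ≡ count (λ w → inSimplex 1 (m ∸ b) w ∧ Q (b ∷ w)) (vectors d n)
    induction b = count-simplex-neg n d (m ∸ b) (λ w → Q (b ∷ w)) (≤-<-trans (m∸n≤m m b) m<n)

module Estimates where

  open import Data.Nat
  open import Data.Nat.Properties
  open import Data.Nat.Tactic.RingSolver using (solve-∀)
  open import Relation.Binary.PropositionalEquality using (_≡_; sym; cong; subst)
  open FiniteSums
  open Binomial using (binomial-upper)
  open CommonDivisors using (modulus)

  -- Telescoping against 1/(4+2i) - 1/(6+2i) = 2/((4+2i)(6+2i)) ≥ 2/(5+2i)².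
  oddSquares-telescope : ∀ (x : ℕ → ℕ) A → (∀ i → (5 + i * 2) * (5 + i * 2) * x i ≤ A) →
                         ∀ k → 8 * (4 + k * 2) * ∑ k x + 4 * A ≤ (4 + k * 2) * A
  oddSquares-telescope x A bound zero    = ≤-refl
  oddSquares-telescope x A bound (suc k) = *-cancelˡ-≤ u (+-cancelʳ-≤ (8 * A) _ _ (begin
    u * (8 * u′ * ∑ (suc k) x + 4 * A) + 8 * A         ≡⟨ cong (λ S → u * (8 * u′ * S + 4 * A) + 8 * A) (∑-last k x) ⟩
    u * (8 * u′ * (∑ k x + x k) + 4 * A) + 8 * A       ≡⟨ regroup (k * 2) (∑ k x) (x k) A ⟩
    u′ * (8 * u * ∑ k x + 4 * A) + 8 * (u * u′ * x k)  ≤⟨ +-mono-≤ (*-monoʳ-≤ u′ (oddSquares-telescope x A bound k)) (*-monoʳ-≤ 8 uu′x≤A) ⟩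
    u′ * (u * A) + 8 * A                               ≡⟨ cong (_+ 8 * A) (*-comm-middle u′ u A) ⟩
    u * (u′ * A) + 8 * A                               ∎))
    where
    open ≤-Reasoning
    u u′ : ℕ
    u  = 4 + k * 2
    u′ = 6 + k * 2
    uu′x≤A : u * u′ * x k ≤ A
    uu′x≤A = ≤-trans (*-monoˡ-≤ (x k) (≤-trans (m≤m+n (u * u′) 1) (≤-reflexive (square (k * 2))))) (bound k)
      where
      square : ∀ y → (4 + y) * (6 + y) + 1 ≡ (5 + y) * (5 + y)
      square = solve-∀
    regroup : ∀ y S X A → (4 + y) * (8 * (6 + y) * (S + X) + 4 * A) + 8 * A
                        ≡ (6 + y) * (8 * (4 + y) * S + 4 * A) + 8 * ((4 + y) * (6 + y) * X)
    regroup = solve-∀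
    *-comm-middle : ∀ a b c → a * (b * c) ≡ b * (a * c)
    *-comm-middle = solve-∀

  oddSquares-≤ : ∀ (x : ℕ → ℕ) A → (∀ i → (5 + i * 2) * (5 + i * 2) * x i ≤ A) → ∀ k → 8 * ∑ k x ≤ A
  oddSquares-≤ x A bound k = *-cancelˡ-≤ (4 + k * 2) (begin
    (4 + k * 2) * (8 * ∑ k x)              ≡⟨ *-assoc-swap (4 + k * 2) 8 (∑ k x) ⟩
    8 * (4 + k * 2) * ∑ k x                ≤⟨ m≤m+n _ (4 * A) ⟩
    8 * (4 + k * 2) * ∑ k x + 4 * A        ≤⟨ oddSquares-telescope x A bound k ⟩
    (4 + k * 2) * A                        ∎)
    where
    open ≤-Reasoning
    *-assoc-swap : ∀ a b c → a * (b * c) ≡ b * a * c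
    *-assoc-swap = solve-∀

  -- 1/2² + 1/3² + (1/5² + 1/7² + … ≤ 1/8) ≤ 35/72.
  modulusSquares-≤ : ∀ (x : ℕ → ℕ) A → (∀ j → modulus j * modulus j * x j ≤ A) → ∀ K → 72 * ∑ K x ≤ 35 * A
  modulusSquares-≤ x A bound K = begin
    72 * ∑ K x                                    ≤⟨ *-monoʳ-≤ 72 (∑-mono-range x (m≤n+m K 2)) ⟩
    72 * (x 0 + (x 1 + (∑[ i < K ] x (2 + i))))   ≡⟨ split (x 0) (x 1) _ ⟩
    18 * (4 * x 0) + 8 * (9 * x 1) + 9 * (8 * (∑[ i < K ] x (2 + i)))
      ≤⟨ +-mono-≤ (+-mono-≤ (*-monoʳ-≤ 18 (bound 0)) (*-monoʳ-≤ 8 (bound 1)))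
                  (*-monoʳ-≤ 9 (oddSquares-≤ (λ i → x (2 + i)) A (λ i → bound (2 + i)) K)) ⟩
    18 * A + 8 * A + 9 * A                        ≡⟨ total A ⟩
    35 * A                                        ∎
    where
    open ≤-Reasoning
    split : ∀ a b c → 72 * (a + (b + c)) ≡ 18 * (4 * a) + 8 * (9 * b) + 9 * (8 * c)
    split = solve-∀
    total : ∀ A → 18 * A + 8 * A + 9 * A ≡ 35 * A
    total = solve-∀

  pow∸-lower : ∀ n d → 72 * d * d ≤ n → 71 * n ^ d ≤ 72 * (n ∸ d) ^ d
  pow∸-lower n zero    _     = n≤1+n 71
  pow∸-lower n d@(suc k) 72d²≤n = subst (λ n → 71 * n ^ d ≤ 72 * a ^ d) (m∸n+n≡m d≤n) (+-cancelʳ-≤ N _ _ (begin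
    71 * N + N                  ≡⟨ collect N ⟩
    72 * N                      ≤⟨ *-monoʳ-≤ 72 (binomial-upper a d k) ⟩
    72 * (a ^ d + d * d * Y)    ≡⟨ expand (a ^ d) d Y ⟩
    72 * a ^ d + 72 * d * d * Y ≤⟨ +-monoʳ-≤ (72 * a ^ d) (*-monoˡ-≤ Y (subst (72 * d * d ≤_) (sym (m∸n+n≡m d≤n)) 72d²≤n)) ⟩
    72 * a ^ d + (a + d) * Y    ∎))
    where
    open ≤-Reasoning
    d≤n : d ≤ n
    d≤n = ≤-trans (≤-trans (m≤n*m d 72) (m≤m*n (72 * d) d)) 72d²≤n
    a N Y : ℕ
    a = n ∸ d
    N = (a + d) ^ d
    Y = (a + d) ^ k
    collect : ∀ N → 71 * N + N ≡ 72 * N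
    collect = solve-∀
    expand : ∀ P d Y → 72 * (P + d * d * Y) ≡ 72 * P + 72 * d * d * Y
    expand = solve-∀

module DensityBounds where

  open import Defs using (vectors; zeroSumFree; gcdWithIsOne; β)
  open import Data.Bool using (Bool; T; _∧_; not)
  open import Data.Bool.Properties using (T-∧; T-not-≡)
  open import Data.Nat
  open import Data.Nat.Properties
  open import Data.Vec using (Vec; sum)
  open import Data.Vec.Relation.Unary.All as Vecₐ using ()
  open import Data.List using (List)
  open import Data.Product using (Σ-syntax; _×_; _,_; proj₁)
  open import Data.Empty using (⊥)
  open import Function using (_∘_; Equivalence)
  open import Relation.Binary.PropositionalEquality
  open import Data.Nat.Tactic.RingSolver using (solve-∀)
  open FiniteSums
  open Counting
  open Simplex
  open ZeroSumFree
  open CommonDivisors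
  open Symmetry
  open Estimates

  β-≤-pow : ∀ n d → β n d ≤ n ^ d
  β-≤-pow n d = subst (_≤ n ^ d) (sym (length-filterᵇ _ (vectors d n))) (count-vectors-≤ d n _)

  module _ (d m : ℕ) where

    isGood isBad : Vec ℕ d → Bool
    isGood v = inSimplex 1 m v ∧ gcdWithIsOne (suc m) v
    isBad  v = inSimplex 1 m v ∧ not (gcdWithIsOne (suc m) v)

    good⇒zeroSumFree : ∀ v → T (isGood v) → T (zeroSumFree (suc m) v ∧ gcdWithIsOne (suc m) v)
    good⇒zeroSumFree v good =
      let inS , coprime = Equivalence.to T-∧ good
      in  Equivalence.from T-∧ (zeroSumFree-small v (inSimplex-positive 1 m v inS) (s≤s (inSimplex-sum 1 m v inS)) , coprime)

    negGood⇒zeroSumFree : ∀ v → T (isGood (neg (suc m) v)) → T (zeroSumFree (suc m) v ∧ gcdWithIsOne (suc m) v)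
    negGood⇒zeroSumFree v negGood =
      let inS , coprime = Equivalence.to T-∧ negGood
          v<n = neg-positive⇒< v (inSimplex-positive 1 m (neg (suc m) v) inS)
      in  Equivalence.from T-∧ (zeroSumFree-neg v v<n (s≤s (inSimplex-sum 1 m (neg (suc m) v) inS)) ,
                                gcdWithIsOne-neg v v<n coprime)

    good-negGood-disjoint : 2 ≤ d → ∀ v → T (isGood v) → T (isGood (neg (suc m) v)) → ⊥
    good-negGood-disjoint 2≤d v good negGood = <⇒≱ (+-mono-< (n<1+n m) (n<1+n m)) (begin
      suc m + suc m                   ≡⟨ cong (suc m +_) (+-identityʳ (suc m)) ⟨
      2 * suc m                       ≤⟨ *-monoˡ-≤ (suc m) 2≤d ⟩
      d * suc m                       ≡⟨ sum+sum-neg v v<n ⟨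
      sum v + sum (neg (suc m) v)     ≤⟨ +-mono-≤ (inSimplex-sum 1 m v inS) (inSimplex-sum 1 m (neg (suc m) v) inS⁻) ⟩
      m + m                           ∎)
      where
      open ≤-Reasoning
      inS : T (inSimplex 1 m v)
      inS = proj₁ (Equivalence.to T-∧ good)
      inS⁻ : T (inSimplex 1 m (neg (suc m) v))
      inS⁻ = proj₁ (Equivalence.to T-∧ negGood)
      v<n : Vecₐ.All (_< suc m) v
      v<n = neg-positive⇒< v (inSimplex-positive 1 m (neg (suc m) v) inS⁻)

    countGood-twice-≤ : 2 ≤ d → count isGood (vectors d (suc m)) + count isGood (vectors d (suc m)) ≤ β (suc m) d
    countGood-twice-≤ 2≤d = begin
      count isGood xs + count isGood xs
        ≡⟨ cong (count isGood xs +_) (count-simplex-neg (suc m) d m (gcdWithIsOne (suc m)) ≤-refl) ⟨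
      count isGood xs + count (isGood ∘ neg (suc m)) xs
        ≤⟨ count-disjoint-≤ good⇒zeroSumFree negGood⇒zeroSumFree (good-negGood-disjoint 2≤d) xs ⟩
      count (λ v → zeroSumFree (suc m) v ∧ gcdWithIsOne (suc m) v) xs
        ≡⟨ length-filterᵇ _ xs ⟨
      β (suc m) d
        ∎
      where
      open ≤-Reasoning
      xs : List (Vec ℕ d)
      xs = vectors d (suc m)

    countBad-≤ : 2 ≤ d → 72 * (d ! * count isBad (vectors d (suc m))) ≤ 35 * suc m ^ d
    countBad-≤ 2≤d = begin
      72 * (d ! * count isBad xs)
        ≤⟨ *-monoʳ-≤ 72 (*-monoʳ-≤ (d !) (count-union-≤ isBad (λ j → inSimplex (modulus j) m) (suc m) badCovered xs)) ⟩
      72 * (d ! * (∑[ j < suc m ] simplexCount (suc m) (modulus j) d m))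
        ≡⟨ cong (72 *_) (*-distribˡ-∑ (d !) (suc m) (λ j → simplexCount (suc m) (modulus j) d m)) ⟩
      72 * (∑[ j < suc m ] d ! * simplexCount (suc m) (modulus j) d m)
        ≤⟨ modulusSquares-≤ (λ j → d ! * simplexCount (suc m) (modulus j) d m) (m ^ d)
                            (λ j → simplexCount-upper² (suc m) (modulus j) {{modulus-nonZero j}} d m 2≤d) (suc m) ⟩
      35 * m ^ d
        ≤⟨ *-monoʳ-≤ 35 (^-monoˡ-≤ d (n≤1+n m)) ⟩
      35 * suc m ^ d
        ∎
      where
      open ≤-Reasoning
      xs : List (Vec ℕ d)
      xs = vectors d (suc m)
      badCovered : ∀ v → T (isBad v) → Σ[ j ∈ ℕ ] j < suc m × T (inSimplex (modulus j) m v)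
      badCovered v bad =
        let inS , notCoprime = Equivalence.to T-∧ bad
            j , j<n , mⱼ∣v   = nonCoprime⇒commonModulus v (subst T (Equivalence.to T-not-≡ notCoprime))
        in  j , j<n , inSimplex-coarsen (modulus j) v inS mⱼ∣v

  private
    combine : ∀ N P F G B → 71 * N ≤ 72 * P → P ≤ F * (G + B) → 72 * (F * B) ≤ 35 * N → N ≤ F * (G + G)
    combine N P F G B 71N≤72P P≤F[G+B] bad≤ = *-cancelˡ-≤ 36 (+-cancelʳ-≤ (35 * N) _ _ (begin
      36 * N + 35 * N                      ≡⟨ collect N ⟩
      71 * N                               ≤⟨ 71N≤72P ⟩
      72 * P                               ≤⟨ *-monoʳ-≤ 72 P≤F[G+B] ⟩
      72 * (F * (G + B))                   ≡⟨ split F G B ⟩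
      36 * (F * (G + G)) + 72 * (F * B)    ≤⟨ +-monoʳ-≤ (36 * (F * (G + G))) bad≤ ⟩
      36 * (F * (G + G)) + 35 * N          ∎))
      where
      open ≤-Reasoning
      collect : ∀ N → 36 * N + 35 * N ≡ 71 * N
      collect = solve-∀
      split : ∀ F G B → 72 * (F * (G + B)) ≡ 36 * (F * (G + G)) + 72 * (F * B)
      split = solve-∀

  pow-≤-factorial*β : ∀ d m → 2 ≤ d → 72 * d * d ≤ suc m → suc m ^ d ≤ d ! * β (suc m) d
  pow-≤-factorial*β d m 2≤d large = ≤-trans
    (combine (suc m ^ d) ((suc m ∸ d) ^ d) (d !) good bad
             (pow∸-lower (suc m) d large)
             (subst (λ s → (suc m ∸ d) ^ d ≤ d ! * s) (count-split (inSimplex 1 m) (gcdWithIsOne (suc m)) xs)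
                    (simplexCount-lower (suc m) d m ≤-refl))
             (countBad-≤ d m 2≤d))
    (*-monoʳ-≤ (d !) (countGood-twice-≤ d m 2≤d))
    where
    xs : List (Vec ℕ d)
    xs = vectors d (suc m)
    good bad : ℕ
    good = count (isGood d m) xs
    bad  = count (isBad d m) xs

module RationalBounds where

  open import Defs using (powOverFact; zetaPartial; _^ℚ_)
  open import Data.Nat as ℕ using (ℕ; suc; _!)
  open import Data.Nat.Properties as ℕ using (_!≢0)
  open import Data.Integer as ℤ using (+_)
  import Data.Integer.Properties as ℤ
  open import Data.Rational using (_/_; _*_; _≤_; 0ℚ; 1ℚ)
  open import Data.Rational.Properties using (toℚᵘ-cancel-≤; toℚᵘ-fromℚᵘ; *-identityʳ; +-identityˡ)
  import Data.Rational.Unnormalised as ℚᵘ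
  import Data.Rational.Unnormalised.Properties as ℚᵘ
  open import Relation.Binary.PropositionalEquality

  /-≤-/1 : ∀ a b c .{{_ : ℕ.NonZero b}} → a ℕ.≤ c ℕ.* b → (+ a) / b ≤ (+ c) / 1
  /-≤-/1 a (suc b) c a≤cb = toℚᵘ-cancel-≤
    (ℚᵘ.≤-respʳ-≃ (ℚᵘ.≃-sym (toℚᵘ-fromℚᵘ (ℚᵘ.mkℚᵘ (+ c) 0)))
      (ℚᵘ.≤-respˡ-≃ (ℚᵘ.≃-sym (toℚᵘ-fromℚᵘ (ℚᵘ.mkℚᵘ (+ a) b)))
        (ℚᵘ.*≤* (subst₂ ℤ._≤_ (ℤ.pos-* a 1) (ℤ.pos-* c (suc b))
                               (ℤ.+≤+ (subst (ℕ._≤ c ℕ.* suc b) (sym (ℕ.*-identityʳ a)) a≤cb))))))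

  zetaPartial-1 : ∀ d → zetaPartial d 1 ≡ 1ℚ
  zetaPartial-1 d = trans (cong (0ℚ Data.Rational.+_) (one^ d)) (+-identityˡ 1ℚ)
    where
    one^ : ∀ d → ((+ 1) / 1) ^ℚ d ≡ 1ℚ
    one^ ℕ.zero    = refl
    one^ (suc d) = cong ((+ 1) / 1 *_) (one^ d)

  powOverFact-≤ : ∀ n d b → n ℕ.^ d ℕ.≤ d ! ℕ.* b → powOverFact n d ≤ ((+ b) / 1) * zetaPartial d 1
  powOverFact-≤ n d b n^d≤d!b = subst (powOverFact n d ≤_) (sym (trans (cong ((+ b) / 1 *_) (zetaPartial-1 d)) (*-identityʳ _)))
    (/-≤-/1 (n ℕ.^ d) (d !) b {{d !≢0}} (subst (n ℕ.^ d ℕ.≤_) (ℕ.*-comm (d !) b) n^d≤d!b))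

open import Defs
open import Data.Nat using (ℕ; _≤_; _<_; _^_)
open import Data.Integer using (+_)
open import Data.Rational using (ℚ; _/_; _*_) renaming (_<_ to _<ℚ_)
open import Data.Product using (Σ; _×_; _,_)
import Data.Nat as ℕ
import Data.Nat.Properties as ℕ
import Data.Rational.Properties as ℚ
open DensityBounds using (β-≤-pow; pow-≤-factorial*β)
open RationalBounds using (powOverFact-≤)

theorem6p5 : (d : ℕ) → 2 ≤ d →
    Σ ℕ (λ N → 0 < N × ((n : ℕ) → N < n →
      ((r : ℚ) → r <ℚ powOverFact n d → Σ ℕ (λ K → r <ℚ ((+ β n d) / 1) * zetaPartial d K))
      × β n d ≤ n ^ d))
theorem6p5 d 2≤d@(ℕ.s≤s (ℕ.s≤s _)) = 72 ℕ.* d ℕ.* d , ℕ.z<s , λ where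
  (ℕ.suc m) N<n →
    (λ r r<n^d/d! → 1 , ℚ.<-≤-trans r<n^d/d! (powOverFact-≤ (ℕ.suc m) d (β (ℕ.suc m) d)
                                                 (pow-≤-factorial*β d m 2≤d (ℕ.<⇒≤ N<n)))) ,
    β-≤-pow (ℕ.suc m) d
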